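{- Let $G$ be a $d$-regular graph with $|V(G)|$ even, and let $D_d\subseteq[0,1]^2$ be the convex hull of the $2(d+1)$ points \[ \left\{\left(\tfrac{l}{d},\tfrac{l^2}{d^2}\right):0\le l\le d\right\}\cup\left\{\left(\tfrac{l^2}{d^2},\tfrac{l}{d}\right):0\le l\le d\right\}. \] Then for every balanced colouring $(R,B)$ of $G$, the pair $(P_2(R),P_2(B))$ lies in $D_d$.
   Context: A balanced colouring of $G$ is a partition $V(G)=R\cup B$ with $|R|=|B|$. A random walk on $G$ moves at each step to a uniformly random neighbour of its current vertex. For $S\subseteq V(G)$, $(W^S_i)_{i\ge0}$ is the random walk with $W^S_0$ uniformly random in $S$, and $P_2(S)=\mathbb P(W^S_1\in S,W^S_2\in S)$. -}

module Defs where

open import Data.Nat as N using (ℕ; zero; suc)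
open import Data.Integer using (+_)
open import Data.Rational using (ℚ; _/_; 0ℚ; 1ℚ; _+_; _*_; _≤_)
open import Data.Bool using (Bool; true; false; if_then_else_; _∧_)
open import Data.Fin using (Fin; toℕ)
open import Data.Fin.Subset using (Subset; ∣_∣)
open import Data.Vec using (lookup)
open import Data.Product using (Σ; _×_; ∃)
open import Relation.Binary.PropositionalEquality using (_≡_)

ℕ→ℚ : ℕ → ℚ
ℕ→ℚ k = + k / 1

-- total reciprocal of a natural number; inv 0 = 0 is a harmless convention
-- (it is never used in the theorem, where all denominators are positive)
inv : ℕ → ℚ
inv zero = 0ℚ
inv (suc k) = + 1 / suc k

sumFin : (n : ℕ) → (Fin n → ℚ) → ℚ
sumFin zero f = 0ℚ
sumFin (suc n) f = f Fin.zero + sumFin n (λ i → f (Fin.suc i))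
  where import Data.Fin as Fin

countFin : (n : ℕ) → (Fin n → Bool) → ℕ
countFin zero P = 0
countFin (suc n) P = (if P Data.Fin.zero then 1 else 0) N.+ countFin n (λ i → P (Data.Fin.suc i))
  where import Data.Fin

𝟙 : Bool → ℚ
𝟙 true = 1ℚ
𝟙 false = 0ℚ

record Graph (n : ℕ) : Set where
  field
    adj : Fin n → Fin n → Bool
    sym : ∀ u v → adj u v ≡ adj v u
    irrefl : ∀ v → adj v v ≡ false

open Graph public

deg : ∀ {n} → Graph n → Fin n → ℕ
deg {n} G v = countFin n (adj G v)

Regular : ∀ {n} → ℕ → Graph n → Set
Regular d G = ∀ v → deg G v ≡ d

-- P₂(S) = P(W₁ ∈ S, W₂ ∈ S) for the simple random walk with W₀ uniform in S:
--   Σ_{v∈S} 1/|S| · Σ_{u ~ v} 1/deg v · [u∈S] · Σ_{w ~ u} 1/deg u · [w∈S]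
P₂ : ∀ {n} → Graph n → Subset n → ℚ
P₂ {n} G S =
  sumFin n λ v → 𝟙 (lookup S v) * inv ∣ S ∣ *
    sumFin n λ u → 𝟙 (adj G v u ∧ lookup S u) * inv (deg G v) *
      sumFin n λ w → 𝟙 (adj G u w ∧ lookup S w) * inv (deg G u)

-- D_d: convex hull of {(l/d, l²/d²)} ∪ {(l²/d², l/d)}, 0 ≤ l ≤ d,
-- as the set of convex combinations of these 2(d+1) points.
InD : ℕ → ℚ → ℚ → Set
InD d x y =
  Σ (Fin (suc d) → ℚ) λ α → Σ (Fin (suc d) → ℚ) λ β →
    (∀ l → 0ℚ ≤ α l) × (∀ l → 0ℚ ≤ β l) ×
    (sumFin (suc d) α + sumFin (suc d) β ≡ 1ℚ) ×
    (x ≡ sumFin (suc d) (λ l → α l * (ℕ→ℚ (toℕ l) * inv d))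
         + sumFin (suc d) (λ l → β l * (ℕ→ℚ (toℕ l N.* toℕ l) * inv (d N.* d)))) ×
    (y ≡ sumFin (suc d) (λ l → α l * (ℕ→ℚ (toℕ l N.* toℕ l) * inv (d N.* d)))
         + sumFin (suc d) (λ l → β l * (ℕ→ℚ (toℕ l) * inv d)))

-- Let m = |R| = |B| and let N_S(u) be the number of neighbours of u in S. Since G is d-regular,
-- P₂(S) = Σ_{u∈S} N_S(u)² / (m d²). Putting mass 1/m on the point (l/d, l²/d²) for each u ∈ S
-- with N_S(u) = l exhibits (s_S, P₂(S)) as a point of D_d, where s_S = Σ_{u∈S} N_S(u) / (m d)
-- = 2 e(S) / (m d); by the symmetry of D_d also (P₂(S), s_S) ∈ D_d. Balance forces
-- 2 e(R) = m d − e(R, B) = 2 e(B), so s_R = s_B =: s, and N_S(u) ≤ d gives P₂(S) ≤ s. Hence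
-- (P₂(R), P₂(B)) is a convex combination of (P₂(R), s), (s, P₂(B)) and (0, 0), which all lie
-- in the convex set D_d.
module Submission where

open import Defs

-- Kept in an anonymous module so that the rational _+_, _*_ and _≤_ opened here do not clash
-- with the natural-number operators used in the statement of theorem1.
module _ where
  open import Level using (0ℓ)
  open import Algebra.Bundles using (CommutativeRing)
  open import Data.Bool using (Bool; true; false; not; _∧_)
  open import Data.Fin using (Fin; toℕ)
  import Data.Fin as Fin
  open import Data.Fin.Subset using (Subset; ∣_∣; ∁)
  open import Data.Fin.Subset.Properties using (∣∁p∣≡n∸∣p∣)
  import Data.Integer as ℤ
  import Data.Integer.Properties as ℤ
  open import Data.Maybe using (Maybe; just; nothing)
  open import Data.Nat using (ℕ; NonZero; zero; suc; s≤s)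
  import Data.Nat as ℕ
  import Data.Nat.Properties as ℕ
  open import Data.Nat.Coprimality using (1-coprimeTo) renaming (sym to coprime-sym)
  open import Data.Product using (_,_)
  open import Data.Rational using (ℚ; 0ℚ; 1ℚ; mkℚ; _+_; _*_; _≤_; 1/_)
  import Data.Rational as ℚ
  import Data.Rational.Properties as ℚ
  open import Data.Vec using (_∷_; []; lookup)
  open import Data.Vec.Properties using (lookup-map)
  open import Relation.Binary.PropositionalEquality
    using (_≡_; refl; trans; cong; cong₂; subst₂; _≗_; module ≡-Reasoning)
  import Relation.Binary.PropositionalEquality as ≡
  open import Relation.Nullary using (yes; no)
  open import Algebra.Properties.Group ℚ.+-0-group using () renaming (∙-cancelʳ to +-cancelʳ)
  open import Algebra.Properties.Semiring.Sum (CommutativeRing.semiring ℚ.+-*-commutativeRing)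
    using (sum; ∑-comm; ∑-distrib-+; *-distribˡ-sum; *-distribʳ-sum; sum-cong-≗; sum-replicate-zero)
  import Tactic.RingSolver.Core.AlmostCommutativeRing as ACR
  open import Tactic.RingSolver using (solve-∀)

  ℚ-ring : ACR.AlmostCommutativeRing 0ℓ 0ℓ
  ℚ-ring = ACR.fromCommutativeRing ℚ.+-*-commutativeRing isZero
    where
    isZero : ∀ x → Maybe (0ℚ ≡ x)
    isZero x with 0ℚ ℚ.≟ x
    ... | yes 0≡x = just 0≡x
    ... | no _ = nothing

  sumFin≗sum : ∀ n (f : Fin n → ℚ) → sumFin n f ≡ sum f
  sumFin≗sum zero f = refl
  sumFin≗sum (suc n) f = cong ((f Fin.zero) +_) (sumFin≗sum n (λ i → f (Fin.suc i)))

  sumFin-cong : ∀ n {f g : Fin n → ℚ} → f ≗ g → sumFin n f ≡ sumFin n g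
  sumFin-cong n {f} {g} f≗g = begin
    sumFin n f ≡⟨ sumFin≗sum n f ⟩
    sum f      ≡⟨ sum-cong-≗ f≗g ⟩
    sum g      ≡⟨ sumFin≗sum n g ⟨
    sumFin n g ∎
    where open ≡-Reasoning

  sumFin-zero : ∀ n {f : Fin n → ℚ} → (∀ i → f i ≡ 0ℚ) → sumFin n f ≡ 0ℚ
  sumFin-zero n {f} f≗0 = begin
    sumFin n f          ≡⟨ sumFin-cong n f≗0 ⟩
    sumFin n (λ _ → 0ℚ) ≡⟨ sumFin≗sum n _ ⟩
    sum {n} (λ _ → 0ℚ)  ≡⟨ sum-replicate-zero n ⟩
    0ℚ                  ∎
    where open ≡-Reasoning

  sumFin-+ : ∀ n (f g : Fin n → ℚ) → sumFin n (λ i → f i + g i) ≡ sumFin n f + sumFin n g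
  sumFin-+ n f g = begin
    sumFin n (λ i → f i + g i) ≡⟨ sumFin≗sum n _ ⟩
    sum (λ i → f i + g i)      ≡⟨ ∑-distrib-+ f g ⟩
    sum f + sum g              ≡⟨ cong₂ _+_ (sumFin≗sum n f) (sumFin≗sum n g) ⟨
    sumFin n f + sumFin n g    ∎
    where open ≡-Reasoning

  *-distribˡ-sumFin : ∀ n c (f : Fin n → ℚ) → c * sumFin n f ≡ sumFin n (λ i → c * f i)
  *-distribˡ-sumFin n c f = begin
    c * sumFin n f          ≡⟨ cong (c *_) (sumFin≗sum n f) ⟩
    c * sum f               ≡⟨ *-distribˡ-sum c f ⟩
    sum (λ i → c * f i)     ≡⟨ sumFin≗sum n _ ⟨
    sumFin n (λ i → c * f i) ∎
    where open ≡-Reasoning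

  *-distribʳ-sumFin : ∀ n c (f : Fin n → ℚ) → sumFin n f * c ≡ sumFin n (λ i → f i * c)
  *-distribʳ-sumFin n c f = begin
    sumFin n f * c           ≡⟨ cong (_* c) (sumFin≗sum n f) ⟩
    sum f * c                ≡⟨ *-distribʳ-sum c f ⟩
    sum (λ i → f i * c)      ≡⟨ sumFin≗sum n _ ⟨
    sumFin n (λ i → f i * c) ∎
    where open ≡-Reasoning

  sumFin-comm : ∀ m n (f : Fin m → Fin n → ℚ) →
    sumFin m (λ i → sumFin n (f i)) ≡ sumFin n (λ j → sumFin m (λ i → f i j))
  sumFin-comm m n f = begin
    sumFin m (λ i → sumFin n (f i))          ≡⟨ sumFin-cong m (λ i → sumFin≗sum n (f i)) ⟩
    sumFin m (λ i → sum (f i))               ≡⟨ sumFin≗sum m _ ⟩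
    sum (λ i → sum (f i))                    ≡⟨ ∑-comm f ⟩
    sum (λ j → sum (λ i → f i j))            ≡⟨ sumFin≗sum n _ ⟨
    sumFin n (λ j → sum (λ i → f i j))       ≡⟨ sumFin-cong n (λ j → sumFin≗sum m (λ i → f i j)) ⟨
    sumFin n (λ j → sumFin m (λ i → f i j))  ∎
    where open ≡-Reasoning

  sumFin-linear₃ : ∀ n p q r (f g h : Fin n → ℚ) →
    sumFin n (λ i → p * f i + q * g i + r * h i)
      ≡ p * sumFin n f + q * sumFin n g + r * sumFin n h
  sumFin-linear₃ n p q r f g h = begin
    sumFin n (λ i → p * f i + q * g i + r * h i)
      ≡⟨ sumFin-+ n _ _ ⟩
    sumFin n (λ i → p * f i + q * g i) + sumFin n (λ i → r * h i)
      ≡⟨ cong (_+ _) (sumFin-+ n _ _) ⟩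
    sumFin n (λ i → p * f i) + sumFin n (λ i → q * g i) + sumFin n (λ i → r * h i)
      ≡⟨ cong₂ _+_ (cong₂ _+_ (*-distribˡ-sumFin n p f) (*-distribˡ-sumFin n q g))
                   (*-distribˡ-sumFin n r h) ⟨
    p * sumFin n f + q * sumFin n g + r * sumFin n h ∎
    where open ≡-Reasoning

  0≤sumFin : ∀ n {f : Fin n → ℚ} → (∀ i → 0ℚ ≤ f i) → 0ℚ ≤ sumFin n f
  0≤sumFin zero 0≤f = ℚ.≤-refl
  0≤sumFin (suc n) 0≤f = ℚ.+-mono-≤ (0≤f Fin.zero) (0≤sumFin n (λ i → 0≤f (Fin.suc i)))

  0≤* : ∀ {p q} → 0ℚ ≤ p → 0ℚ ≤ q → 0ℚ ≤ p * q
  0≤* {p} {q} 0≤p 0≤q = ℚ.nonNegative⁻¹ (p * q)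
    {{ℚ.nonNeg*nonNeg⇒nonNeg p {{ℚ.nonNegative 0≤p}} q {{ℚ.nonNegative 0≤q}}}}

  ℕ→ℚ-canonical : ∀ k → ℕ→ℚ k ≡ mkℚ (ℤ.+ k) 0 (coprime-sym (1-coprimeTo k))
  ℕ→ℚ-canonical k = ℚ.normalize-coprime (coprime-sym (1-coprimeTo k))

  ℕ→ℚ-+ : ∀ m n → ℕ→ℚ (m ℕ.+ n) ≡ ℕ→ℚ m + ℕ→ℚ n
  ℕ→ℚ-+ m n = begin
    ℤ.+ (m ℕ.+ n) ℚ./ 1                                 ≡⟨ ℚ./-cong numerator refl ⟩
    (ℤ.+ m ℤ.* ℤ.+ 1 ℤ.+ ℤ.+ n ℤ.* ℤ.+ 1) ℚ./ (1 ℕ.* 1)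
      ≡⟨ cong₂ _+_ (ℕ→ℚ-canonical m) (ℕ→ℚ-canonical n) ⟨
    ℕ→ℚ m + ℕ→ℚ n                                       ∎
    where
    open ≡-Reasoning
    numerator : ℤ.+ (m ℕ.+ n) ≡ ℤ.+ m ℤ.* ℤ.+ 1 ℤ.+ ℤ.+ n ℤ.* ℤ.+ 1
    numerator = trans (ℤ.pos-+ m n) (≡.sym (cong₂ ℤ._+_ (ℤ.*-identityʳ (ℤ.+ m)) (ℤ.*-identityʳ (ℤ.+ n))))

  ℕ→ℚ-* : ∀ m n → ℕ→ℚ (m ℕ.* n) ≡ ℕ→ℚ m * ℕ→ℚ n
  ℕ→ℚ-* m n = begin
    ℤ.+ (m ℕ.* n) ℚ./ 1             ≡⟨ ℚ./-cong (ℤ.pos-* m n) refl ⟩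
    (ℤ.+ m ℤ.* ℤ.+ n) ℚ./ (1 ℕ.* 1) ≡⟨ cong₂ _*_ (ℕ→ℚ-canonical m) (ℕ→ℚ-canonical n) ⟨
    ℕ→ℚ m * ℕ→ℚ n                   ∎
    where open ≡-Reasoning

  0≤ℕ→ℚ : ∀ k → 0ℚ ≤ ℕ→ℚ k
  0≤ℕ→ℚ k = ℚ.nonNegative⁻¹ _ {{ℚ.normalize-nonNeg k 1}}

  0≤inv : ∀ k → 0ℚ ≤ inv k
  0≤inv zero = ℚ.≤-refl
  0≤inv (suc k) = ℚ.nonNegative⁻¹ _ {{ℚ.normalize-nonNeg 1 (suc k)}}

  ℕ→ℚ*inv : ∀ k .{{_ : NonZero k}} → ℕ→ℚ k * inv k ≡ 1ℚ
  ℕ→ℚ*inv (suc k) = begin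
    ℕ→ℚ (suc k) * inv (suc k)
      ≡⟨ cong₂ _*_ (ℕ→ℚ-canonical (suc k)) (ℚ.normalize-coprime (1-coprimeTo (suc k))) ⟩
    p * 1/ p
      ≡⟨ ℚ.*-inverseʳ p ⟩
    1ℚ ∎
    where
    open ≡-Reasoning
    p = mkℚ (ℤ.+ suc k) 0 (coprime-sym (1-coprimeTo (suc k)))

  inv-* : ∀ m n .{{_ : NonZero m}} .{{_ : NonZero n}} → inv (m ℕ.* n) ≡ inv m * inv n
  inv-* m@(suc _) n@(suc _) = begin
    i                       ≡⟨ ℚ.*-identityʳ i ⟨
    i * 1ℚ                  ≡⟨ cong₂ (λ u v → i * (u * v)) (ℕ→ℚ*inv m) (ℕ→ℚ*inv n) ⟨
    i * ((M * a) * (N * b)) ≡⟨ regroup i M N a b ⟩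
    (M * N * i) * (a * b)   ≡⟨ cong (_* (a * b)) MNi≡1 ⟩
    1ℚ * (a * b)            ≡⟨ ℚ.*-identityˡ (a * b) ⟩
    a * b                   ∎
    where
    open ≡-Reasoning
    i = inv (m ℕ.* n)
    M = ℕ→ℚ m
    N = ℕ→ℚ n
    a = inv m
    b = inv n
    MNi≡1 : M * N * i ≡ 1ℚ
    MNi≡1 = trans (cong (_* i) (≡.sym (ℕ→ℚ-* m n))) (ℕ→ℚ*inv (m ℕ.* n))
    regroup : ∀ i M N a b → i * ((M * a) * (N * b)) ≡ (M * N * i) * (a * b)
    regroup = solve-∀ ℚ-ring

  *-inv[d*d]*d : ∀ c d e .{{_ : NonZero d}} → c * inv (d ℕ.* d) * (ℕ→ℚ d * e) ≡ c * inv d * e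
  *-inv[d*d]*d c d e = begin
    c * inv (d ℕ.* d) * (ℕ→ℚ d * e)       ≡⟨ cong (λ j → c * j * (ℕ→ℚ d * e)) (inv-* d d) ⟩
    c * (inv d * inv d) * (ℕ→ℚ d * e)     ≡⟨ regroup c (inv d) (ℕ→ℚ d) e ⟩
    c * inv d * (ℕ→ℚ d * inv d) * e       ≡⟨ cong (λ z → c * inv d * z * e) (ℕ→ℚ*inv d) ⟩
    c * inv d * 1ℚ * e                    ≡⟨ cong (_* e) (ℚ.*-identityʳ (c * inv d)) ⟩
    c * inv d * e                         ∎
    where
    open ≡-Reasoning
    regroup : ∀ c j D e → c * (j * j) * (D * e) ≡ c * j * (D * j) * e
    regroup = solve-∀ ℚ-ring

  0≤𝟙 : ∀ b → 0ℚ ≤ 𝟙 b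
  0≤𝟙 true = 0≤ℕ→ℚ 1
  0≤𝟙 false = ℚ.≤-refl

  𝟙-∧ : ∀ a b → 𝟙 (a ∧ b) ≡ 𝟙 a * 𝟙 b
  𝟙-∧ true b = ≡.sym (ℚ.*-identityˡ (𝟙 b))
  𝟙-∧ false b = ≡.sym (ℚ.*-zeroˡ (𝟙 b))

  sumFin-𝟙≡countFin : ∀ n (P : Fin n → Bool) → sumFin n (λ i → 𝟙 (P i)) ≡ ℕ→ℚ (countFin n P)
  sumFin-𝟙≡countFin zero P = refl
  sumFin-𝟙≡countFin (suc n) P with P Fin.zero
  ... | true = trans (cong (1ℚ +_) (sumFin-𝟙≡countFin n P′)) (≡.sym (ℕ→ℚ-+ 1 (countFin n P′)))
    where P′ = λ i → P (Fin.suc i)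
  ... | false = trans (ℚ.+-identityˡ _) (sumFin-𝟙≡countFin n (λ i → P (Fin.suc i)))

  sumFin-𝟙≡∣p∣ : ∀ {n} (p : Subset n) → sumFin n (λ i → 𝟙 (lookup p i)) ≡ ℕ→ℚ ∣ p ∣
  sumFin-𝟙≡∣p∣ [] = refl
  sumFin-𝟙≡∣p∣ (true ∷ p) = trans (cong (1ℚ +_) (sumFin-𝟙≡∣p∣ p)) (≡.sym (ℕ→ℚ-+ 1 ∣ p ∣))
  sumFin-𝟙≡∣p∣ (false ∷ p) = trans (ℚ.+-identityˡ _) (sumFin-𝟙≡∣p∣ p)

  countFin-cong : ∀ n {P Q : Fin n → Bool} → P ≗ Q → countFin n P ≡ countFin n Q
  countFin-cong zero P≗Q = refl
  countFin-cong (suc n) {P} P≗Q rewrite P≗Q Fin.zero =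
    cong (_ ℕ.+_) (countFin-cong n (λ i → P≗Q (Fin.suc i)))

  countFin-∧ : ∀ n (P Q : Fin n → Bool) →
    countFin n (λ i → P i ∧ Q i) ℕ.+ countFin n (λ i → P i ∧ not (Q i)) ≡ countFin n P
  countFin-∧ zero P Q = refl
  countFin-∧ (suc n) P Q with P Fin.zero | Q Fin.zero
  ... | true  | true  = cong suc (countFin-∧ n _ _)
  ... | true  | false = trans (ℕ.+-suc _ _) (cong suc (countFin-∧ n _ _))
  ... | false | _     = countFin-∧ n _ _

  sumFin-𝟙[k≡ᵇl] : ∀ d k (f : ℕ → ℚ) → k ℕ.≤ d →
    sumFin (suc d) (λ l → 𝟙 (k ℕ.≡ᵇ toℕ l) * f (toℕ l)) ≡ f k
  sumFin-𝟙[k≡ᵇl] d zero f _ = begin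
    1ℚ * f 0 + sumFin d (λ l → 0ℚ * f (suc (toℕ l)))
      ≡⟨ cong (1ℚ * f 0 +_) (sumFin-zero d (λ l → ℚ.*-zeroˡ (f (suc (toℕ l))))) ⟩
    1ℚ * f 0 + 0ℚ
      ≡⟨ ℚ.+-identityʳ _ ⟩
    1ℚ * f 0
      ≡⟨ ℚ.*-identityˡ _ ⟩
    f 0 ∎
    where open ≡-Reasoning
  sumFin-𝟙[k≡ᵇl] (suc d) (suc k) f (s≤s k≤d) =
    trans (cong (_+ rest) (ℚ.*-zeroˡ (f 0)))
          (trans (ℚ.+-identityˡ rest) (sumFin-𝟙[k≡ᵇl] d k (λ l → f (suc l)) k≤d))
    where rest = sumFin (suc d) (λ l → 𝟙 (k ℕ.≡ᵇ toℕ l) * f (suc (toℕ l)))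

  -- Weights on {0, …, d} and the region D_d

  mean : ∀ d → (Fin (suc d) → ℚ) → (ℕ → ℚ) → ℚ
  mean d a f = sumFin (suc d) (λ l → a l * f (toℕ l))

  linear square : ℕ → ℕ → ℚ
  linear d k = ℕ→ℚ k * inv d
  square d k = ℕ→ℚ (k ℕ.* k) * inv (d ℕ.* d)

  mean-linear₃ : ∀ d p q r (a₁ a₂ a₃ : Fin (suc d) → ℚ) f →
    mean d (λ l → p * a₁ l + q * a₂ l + r * a₃ l) f ≡ p * mean d a₁ f + q * mean d a₂ f + r * mean d a₃ f
  mean-linear₃ d p q r a₁ a₂ a₃ f = trans
    (sumFin-cong (suc d) (λ l → distrib p q r (a₁ l) (a₂ l) (a₃ l) (f (toℕ l))))
    (sumFin-linear₃ (suc d) p q r (λ l → a₁ l * f (toℕ l)) (λ l → a₂ l * f (toℕ l)) (λ l → a₃ l * f (toℕ l)))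
    where
    distrib : ∀ p q r a₁ a₂ a₃ w →
      (p * a₁ + q * a₂ + r * a₃) * w ≡ p * (a₁ * w) + q * (a₂ * w) + r * (a₃ * w)
    distrib = solve-∀ ℚ-ring

  histogram : ∀ {n} d → (Fin n → ℚ) → (Fin n → ℕ) → Fin (suc d) → ℚ
  histogram {n} d w k l = sumFin n (λ u → w u * 𝟙 (k u ℕ.≡ᵇ toℕ l))

  mean-histogram : ∀ {n} d (w : Fin n → ℚ) (k : Fin n → ℕ) → (∀ u → k u ℕ.≤ d) → (g : ℕ → ℚ) →
    mean d (histogram d w k) g ≡ sumFin n (λ u → w u * g (k u))
  mean-histogram {n} d w k k≤d g = begin
    sumFin (suc d) (λ l → histogram d w k l * g (toℕ l))
      ≡⟨ sumFin-cong (suc d) (λ l → *-distribʳ-sumFin n (g (toℕ l)) (λ u → w u * [ u ≡ l ])) ⟩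
    sumFin (suc d) (λ l → sumFin n (λ u → w u * [ u ≡ l ] * g (toℕ l)))
      ≡⟨ sumFin-comm (suc d) n (λ l u → w u * [ u ≡ l ] * g (toℕ l)) ⟩
    sumFin n (λ u → sumFin (suc d) (λ l → w u * [ u ≡ l ] * g (toℕ l)))
      ≡⟨ sumFin-cong n (λ u → sumFin-cong (suc d) (λ l → ℚ.*-assoc (w u) [ u ≡ l ] (g (toℕ l)))) ⟩
    sumFin n (λ u → sumFin (suc d) (λ l → w u * ([ u ≡ l ] * g (toℕ l))))
      ≡⟨ sumFin-cong n (λ u → *-distribˡ-sumFin (suc d) (w u) (λ l → [ u ≡ l ] * g (toℕ l))) ⟨
    sumFin n (λ u → w u * sumFin (suc d) (λ l → [ u ≡ l ] * g (toℕ l)))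
      ≡⟨ sumFin-cong n (λ u → cong (w u *_) (sumFin-𝟙[k≡ᵇl] d (k u) g (k≤d u))) ⟩
    sumFin n (λ u → w u * g (k u)) ∎
    where
    open ≡-Reasoning
    [_≡_] : Fin n → Fin (suc d) → ℚ
    [ u ≡ l ] = 𝟙 (k u ℕ.≡ᵇ toℕ l)

  InD-swap : ∀ {d x y} → InD d x y → InD d y x
  InD-swap {d} (α , β , 0≤α , 0≤β , Σ≡1 , x≡ , y≡) =
    β , α , 0≤β , 0≤α ,
    trans (ℚ.+-comm (sumFin (suc d) β) (sumFin (suc d) α)) Σ≡1 ,
    trans y≡ (ℚ.+-comm (mean d α (square d)) (mean d β (linear d))) ,
    trans x≡ (ℚ.+-comm (mean d α (linear d)) (mean d β (square d)))

  InD-parabola : ∀ d (a : Fin (suc d) → ℚ) → (∀ l → 0ℚ ≤ a l) → sumFin (suc d) a ≡ 1ℚ →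
    InD d (mean d a (linear d)) (mean d a (square d))
  InD-parabola d a 0≤a Σa≡1 =
    a , (λ _ → 0ℚ) , 0≤a , (λ _ → ℚ.≤-refl) ,
    trans (cong (sumFin (suc d) a +_) (sumFin-zero (suc d) (λ _ → refl))) (trans (ℚ.+-identityʳ _) Σa≡1) ,
    +-no-mass (square d) , +-no-mass (linear d)
    where
    +-no-mass : ∀ {x} f → x ≡ x + mean d (λ _ → 0ℚ) f
    +-no-mass {x} f = ≡.sym (trans (cong (x +_) (sumFin-zero (suc d) (λ l → ℚ.*-zeroˡ (f (toℕ l)))))
                                   (ℚ.+-identityʳ x))

  InD-origin : ∀ d → InD d 0ℚ 0ℚ
  InD-origin d =
    subst₂ (InD d) (vanishes (linear d) (ℚ.*-zeroˡ (inv d))) (vanishes (square d) (ℚ.*-zeroˡ (inv (d ℕ.* d))))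
      (InD-parabola d δ₀ 0≤δ₀ Σδ₀≡1)
    where
    δ₀ : Fin (suc d) → ℚ
    δ₀ Fin.zero = 1ℚ
    δ₀ (Fin.suc _) = 0ℚ
    0≤δ₀ : ∀ l → 0ℚ ≤ δ₀ l
    0≤δ₀ Fin.zero = 0≤ℕ→ℚ 1
    0≤δ₀ (Fin.suc _) = ℚ.≤-refl
    Σδ₀≡1 : sumFin (suc d) δ₀ ≡ 1ℚ
    Σδ₀≡1 = trans (cong (1ℚ +_) (sumFin-zero d (λ _ → refl))) (ℚ.+-identityʳ 1ℚ)
    vanishes : ∀ f → f 0 ≡ 0ℚ → mean d δ₀ f ≡ 0ℚ
    vanishes f f0≡0 = sumFin-zero (suc d) {λ l → δ₀ l * f (toℕ l)} λ
      { Fin.zero → trans (ℚ.*-identityˡ (f 0)) f0≡0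
      ; (Fin.suc l) → ℚ.*-zeroˡ (f (suc (toℕ l))) }

  InD-convex₃ : ∀ {d x₁ y₁ x₂ y₂ x₃ y₃} p q r → 0ℚ ≤ p → 0ℚ ≤ q → 0ℚ ≤ r → p + q + r ≡ 1ℚ →
    InD d x₁ y₁ → InD d x₂ y₂ → InD d x₃ y₃ →
    InD d (p * x₁ + q * x₂ + r * x₃) (p * y₁ + q * y₂ + r * y₃)
  InD-convex₃ {d} p q r 0≤p 0≤q 0≤r p+q+r≡1
    (α₁ , β₁ , 0≤α₁ , 0≤β₁ , Σ₁≡1 , x₁≡ , y₁≡)
    (α₂ , β₂ , 0≤α₂ , 0≤β₂ , Σ₂≡1 , x₂≡ , y₂≡)
    (α₃ , β₃ , 0≤α₃ , 0≤β₃ , Σ₃≡1 , x₃≡ , y₃≡) =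
    mix α₁ α₂ α₃ , mix β₁ β₂ β₃ , 0≤mix 0≤α₁ 0≤α₂ 0≤α₃ , 0≤mix 0≤β₁ 0≤β₂ 0≤β₃ , Σ≡1 ,
    trans (combine x₁≡ x₂≡ x₃≡)
          (≡.sym (cong₂ _+_ (mean-linear₃ d p q r α₁ α₂ α₃ (linear d))
                            (mean-linear₃ d p q r β₁ β₂ β₃ (square d)))) ,
    trans (combine y₁≡ y₂≡ y₃≡)
          (≡.sym (cong₂ _+_ (mean-linear₃ d p q r α₁ α₂ α₃ (square d))
                            (mean-linear₃ d p q r β₁ β₂ β₃ (linear d))))
    where
    mix : (a₁ a₂ a₃ : Fin (suc d) → ℚ) → Fin (suc d) → ℚ
    mix a₁ a₂ a₃ l = p * a₁ l + q * a₂ l + r * a₃ l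
    0≤mix : ∀ {a₁ a₂ a₃} → (∀ l → 0ℚ ≤ a₁ l) → (∀ l → 0ℚ ≤ a₂ l) → (∀ l → 0ℚ ≤ a₃ l) →
            ∀ l → 0ℚ ≤ mix a₁ a₂ a₃ l
    0≤mix 0≤a₁ 0≤a₂ 0≤a₃ l =
      ℚ.+-mono-≤ (ℚ.+-mono-≤ (0≤* 0≤p (0≤a₁ l)) (0≤* 0≤q (0≤a₂ l))) (0≤* 0≤r (0≤a₃ l))
    combine : ∀ {u₁ u₂ u₃ a₁ a₂ a₃ b₁ b₂ b₃} → u₁ ≡ a₁ + b₁ → u₂ ≡ a₂ + b₂ → u₃ ≡ a₃ + b₃ →
      p * u₁ + q * u₂ + r * u₃ ≡ (p * a₁ + q * a₂ + r * a₃) + (p * b₁ + q * b₂ + r * b₃)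
    combine refl refl refl = regroup p q r _ _ _ _ _ _
      where
      regroup : ∀ p q r a₁ a₂ a₃ b₁ b₂ b₃ → p * (a₁ + b₁) + q * (a₂ + b₂) + r * (a₃ + b₃)
                                            ≡ (p * a₁ + q * a₂ + r * a₃) + (p * b₁ + q * b₂ + r * b₃)
      regroup = solve-∀ ℚ-ring
    Σ≡1 : sumFin (suc d) (mix α₁ α₂ α₃) + sumFin (suc d) (mix β₁ β₂ β₃) ≡ 1ℚ
    Σ≡1 = begin
      sumFin (suc d) (mix α₁ α₂ α₃) + sumFin (suc d) (mix β₁ β₂ β₃)
        ≡⟨ cong₂ _+_ (sumFin-linear₃ (suc d) p q r α₁ α₂ α₃) (sumFin-linear₃ (suc d) p q r β₁ β₂ β₃) ⟩
      _ ≡⟨ combine (≡.sym Σ₁≡1) (≡.sym Σ₂≡1) (≡.sym Σ₃≡1) ⟨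
      p * 1ℚ + q * 1ℚ + r * 1ℚ
        ≡⟨ cong₂ _+_ (cong₂ _+_ (ℚ.*-identityʳ p) (ℚ.*-identityʳ q)) (ℚ.*-identityʳ r) ⟩
      p + q + r
        ≡⟨ p+q+r≡1 ⟩
      1ℚ ∎
      where open ≡-Reasoning

  -- Points in the triangle spanned by (x, t), (t, y) and the origin

  record TriangleWeights (x y t : ℚ) : Set where
    field
      p q r : ℚ
      0≤p : 0ℚ ≤ p
      0≤q : 0ℚ ≤ q
      0≤r : 0ℚ ≤ r
      p+q+r≡1 : p + q + r ≡ 1ℚ
      x≡ : x ≡ p * x + q * t + r * 0ℚ
      y≡ : y ≡ p * t + q * y + r * 0ℚ

  InD-triangle : ∀ {d x y t} → TriangleWeights x y t → InD d x t → InD d t y → InD d x y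
  InD-triangle {d} w xt ty =
    subst₂ (InD d) (≡.sym x≡) (≡.sym y≡) (InD-convex₃ p q r 0≤p 0≤q 0≤r p+q+r≡1 xt ty (InD-origin d))
    where open TriangleWeights w

  TriangleWeights-scale : ∀ {x y t} k → TriangleWeights x y t → TriangleWeights (k * x) (k * y) (k * t)
  TriangleWeights-scale {x} {y} {t} k w = record
    { p = p ; q = q ; r = r ; 0≤p = 0≤p ; 0≤q = 0≤q ; 0≤r = 0≤r ; p+q+r≡1 = p+q+r≡1
    ; x≡ = trans (cong (k *_) x≡) (scaleX k p q r x t)
    ; y≡ = trans (cong (k *_) y≡) (scaleY k p q r y t)
    }
    where
    open TriangleWeights w
    scaleX : ∀ k p q r x t → k * (p * x + q * t + r * 0ℚ) ≡ p * (k * x) + q * (k * t) + r * 0ℚ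
    scaleX = solve-∀ ℚ-ring
    scaleY : ∀ k p q r y t → k * (p * t + q * y + r * 0ℚ) ≡ p * (k * t) + q * (k * y) + r * 0ℚ
    scaleY = solve-∀ ℚ-ring

  -- Cramer's rule for x = p x + q t, y = p t + q y with t = x + a = y + b: minus the determinant
  -- is t² − x y = t a + x b, whose inverse is i.
  triangleWeights-cramer : ∀ {x y a b i} → 0ℚ ≤ x → 0ℚ ≤ y → 0ℚ ≤ a → 0ℚ ≤ b → 0ℚ ≤ i →
    x + a ≡ y + b → ((x + a) * a + x * b) * i ≡ 1ℚ → TriangleWeights x y (x + a)
  triangleWeights-cramer {x} {y} {a} {b} {i} 0≤x 0≤y 0≤a 0≤b 0≤i x+a≡y+b Di≡1 = record
    { p = y * a * i ; q = x * b * i ; r = a * b * i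
    ; 0≤p = 0≤* (0≤* 0≤y 0≤a) 0≤i ; 0≤q = 0≤* (0≤* 0≤x 0≤b) 0≤i ; 0≤r = 0≤* (0≤* 0≤a 0≤b) 0≤i
    ; p+q+r≡1 = begin
        y * a * i + x * b * i + a * b * i   ≡⟨ collect x y a b i ⟩
        ((y + b) * a + x * b) * i           ≡⟨ cong (λ s → (s * a + x * b) * i) x+a≡y+b ⟨
        ((x + a) * a + x * b) * i           ≡⟨ Di≡1 ⟩
        1ℚ                                  ∎
    ; x≡ = begin
        x                                   ≡⟨ cancel x ⟩
        x * (((x + a) * a + x * b) * i)     ≡⟨ expandX x a b i ⟩
        (x * a * (x + a) + x * x * b) * i   ≡⟨ cong (λ s → (x * a * s + x * x * b) * i) x+a≡y+b ⟩
        (x * a * (y + b) + x * x * b) * i   ≡⟨ collectX x y a b i ⟩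
        y * a * i * x + x * b * i * (x + a) + a * b * i * 0ℚ ∎
    ; y≡ = trans (cancel y) (expandY x y a b i)
    }
    where
    open ≡-Reasoning
    cancel : ∀ z → z ≡ z * (((x + a) * a + x * b) * i)
    cancel z = ≡.sym (trans (cong (z *_) Di≡1) (ℚ.*-identityʳ z))
    collect : ∀ x y a b i → y * a * i + x * b * i + a * b * i ≡ ((y + b) * a + x * b) * i
    collect = solve-∀ ℚ-ring
    expandX : ∀ x a b i → x * (((x + a) * a + x * b) * i) ≡ (x * a * (x + a) + x * x * b) * i
    expandX = solve-∀ ℚ-ring
    collectX : ∀ x y a b i →
      (x * a * (y + b) + x * x * b) * i ≡ y * a * i * x + x * b * i * (x + a) + a * b * i * 0ℚ
    collectX = solve-∀ ℚ-ring
    expandY : ∀ x y a b i →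
      y * (((x + a) * a + x * b) * i) ≡ y * a * i * (x + a) + x * b * i * y + a * b * i * 0ℚ
    expandY = solve-∀ ℚ-ring

  triangleWeights : ∀ {x y a b} → 0ℚ ≤ x → 0ℚ ≤ y → 0ℚ ≤ a → 0ℚ ≤ b → x + a ≡ y + b →
    TriangleWeights x y (x + a)
  triangleWeights {x} {y} {a} {b} 0≤x 0≤y 0≤a 0≤b x+a≡y+b with a ℚ.≟ 0ℚ
  ... | yes refl = record
    { p = 0ℚ ; q = 1ℚ ; r = 0ℚ ; 0≤p = ℚ.≤-refl ; 0≤q = 0≤ℕ→ℚ 1 ; 0≤r = ℚ.≤-refl ; p+q+r≡1 = refl
    ; x≡ = onX x ; y≡ = onY x y }
    where
    onX : ∀ x → x ≡ 0ℚ * x + 1ℚ * (x + 0ℚ) + 0ℚ * 0ℚ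
    onX = solve-∀ ℚ-ring
    onY : ∀ x y → y ≡ 0ℚ * (x + 0ℚ) + 1ℚ * y + 0ℚ * 0ℚ
    onY = solve-∀ ℚ-ring
  ... | no a≢0 =
    triangleWeights-cramer 0≤x 0≤y 0≤a 0≤b (ℚ.<⇒≤ (ℚ.positive⁻¹ (1/ D) {{ℚ.1/pos⇒pos D}})) x+a≡y+b
      (ℚ.*-inverseʳ D)
    where
    D = (x + a) * a + x * b
    instance
      _ : ℚ.NonNegative x
      _ = ℚ.nonNegative 0≤x
      _ : ℚ.NonNegative b
      _ = ℚ.nonNegative 0≤b
      _ : ℚ.Positive a
      _ = ℚ.nonNeg∧nonZero⇒pos a {{ℚ.nonNegative 0≤a}} {{ℚ.≢-nonZero a≢0}}
      _ : ℚ.Positive (x + a)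
      _ = ℚ.nonNeg+pos⇒pos x a
      _ : ℚ.Positive D
      _ = ℚ.pos+nonNeg⇒pos ((x + a) * a) {{ℚ.pos*pos⇒pos (x + a) a}} (x * b) {{ℚ.nonNeg*nonNeg⇒nonNeg x b}}
      _ : ℚ.NonZero D
      _ = ℚ.pos⇒nonZero D

  ∣p∣-nonZero : ∀ {n} (p : Subset n) → 0 ℕ.< n → ∣ p ∣ ≡ ∣ ∁ p ∣ → NonZero ∣ p ∣
  ∣p∣-nonZero {n} p 0<n balanced = ℕ.≢-nonZero λ ∣p∣≡0 → ℕ.<⇒≢ 0<n (≡.sym (begin
    n             ≡⟨ cong (n ℕ.∸_) ∣p∣≡0 ⟨
    n ℕ.∸ ∣ p ∣   ≡⟨ ∣∁p∣≡n∸∣p∣ p ⟨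
    ∣ ∁ p ∣       ≡⟨ balanced ⟨
    ∣ p ∣         ≡⟨ ∣p∣≡0 ⟩
    0             ∎))
    where open ≡-Reasoning

  -- Neighbourhood counts in a graph

  module _ {n} (G : Graph n) where

    degIn : Subset n → Fin n → ℕ
    degIn S u = countFin n (λ w → adj G u w ∧ lookup S w)

    degInℚ : Subset n → Fin n → ℚ
    degInℚ S u = ℕ→ℚ (degIn S u)

    degIn-∁ : ∀ S u → degIn S u ℕ.+ degIn (∁ S) u ≡ deg G u
    degIn-∁ S u = trans
      (cong (degIn S u ℕ.+_) (countFin-cong n (λ w → cong (adj G u w ∧_) (lookup-map w not S))))
      (countFin-∧ n (adj G u) (lookup S))

    degIn≤deg : ∀ S u → degIn S u ℕ.≤ deg G u
    degIn≤deg S u = ≡.subst (degIn S u ℕ.≤_) (degIn-∁ S u) (ℕ.m≤m+n _ _)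

    edges : Subset n → Subset n → ℚ
    edges S T = sumFin n (λ u → 𝟙 (lookup S u) * degInℚ T u)

    squareSum crossSum : Subset n → ℚ
    squareSum S = sumFin n (λ u → 𝟙 (lookup S u) * (degInℚ S u * degInℚ S u))
    crossSum S = sumFin n (λ u → 𝟙 (lookup S u) * (degInℚ S u * degInℚ (∁ S) u))

    0≤squareSum : ∀ S → 0ℚ ≤ squareSum S
    0≤squareSum S =
      0≤sumFin n (λ u → 0≤* (0≤𝟙 (lookup S u)) (0≤* (0≤ℕ→ℚ (degIn S u)) (0≤ℕ→ℚ (degIn S u))))

    0≤crossSum : ∀ S → 0ℚ ≤ crossSum S
    0≤crossSum S =
      0≤sumFin n (λ u → 0≤* (0≤𝟙 (lookup S u)) (0≤* (0≤ℕ→ℚ (degIn S u)) (0≤ℕ→ℚ (degIn (∁ S) u))))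

    sumFin-over-edges : ∀ S T (f : Fin n → ℚ) →
      sumFin n (λ v → 𝟙 (lookup S v) * sumFin n (λ u → 𝟙 (adj G v u ∧ lookup T u) * f u))
        ≡ sumFin n (λ u → 𝟙 (lookup T u) * (f u * degInℚ S u))
    sumFin-over-edges S T f = begin
      sumFin n (λ v → 𝟙 (lookup S v) * sumFin n (λ u → [ v ~ u ∈ T ] * f u))
        ≡⟨ sumFin-cong n (λ v → *-distribˡ-sumFin n (𝟙 (lookup S v)) (λ u → [ v ~ u ∈ T ] * f u)) ⟩
      sumFin n (λ v → sumFin n (λ u → 𝟙 (lookup S v) * ([ v ~ u ∈ T ] * f u)))
        ≡⟨ sumFin-comm n n (λ v u → 𝟙 (lookup S v) * ([ v ~ u ∈ T ] * f u)) ⟩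
      sumFin n (λ u → sumFin n (λ v → 𝟙 (lookup S v) * ([ v ~ u ∈ T ] * f u)))
        ≡⟨ sumFin-cong n (λ u → sumFin-cong n (λ v → reverse-edge u v)) ⟩
      sumFin n (λ u → sumFin n (λ v → 𝟙 (lookup T u) * f u * [ u ~ v ∈ S ]))
        ≡⟨ sumFin-cong n (λ u → *-distribˡ-sumFin n (𝟙 (lookup T u) * f u) (λ v → [ u ~ v ∈ S ])) ⟨
      sumFin n (λ u → 𝟙 (lookup T u) * f u * sumFin n (λ v → [ u ~ v ∈ S ]))
        ≡⟨ sumFin-cong n (λ u →
             trans (cong (𝟙 (lookup T u) * f u *_) (sumFin-𝟙≡countFin n (λ v → adj G u v ∧ lookup S v)))
                   (ℚ.*-assoc (𝟙 (lookup T u)) (f u) (degInℚ S u))) ⟩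
      sumFin n (λ u → 𝟙 (lookup T u) * (f u * degInℚ S u)) ∎
      where
      open ≡-Reasoning
      [_~_∈_] : Fin n → Fin n → Subset n → ℚ
      [ v ~ u ∈ T ] = 𝟙 (adj G v u ∧ lookup T u)
      shuffle : ∀ s e t z → s * (e * t * z) ≡ t * z * (e * s)
      shuffle = solve-∀ ℚ-ring
      reverse-edge : ∀ u v → 𝟙 (lookup S v) * ([ v ~ u ∈ T ] * f u) ≡ 𝟙 (lookup T u) * f u * [ u ~ v ∈ S ]
      reverse-edge u v = begin
        𝟙 (lookup S v) * (𝟙 (adj G v u ∧ lookup T u) * f u)
          ≡⟨ cong (λ e → 𝟙 (lookup S v) * (𝟙 (e ∧ lookup T u) * f u)) (sym G v u) ⟩
        𝟙 (lookup S v) * (𝟙 (adj G u v ∧ lookup T u) * f u)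
          ≡⟨ cong (λ e → 𝟙 (lookup S v) * (e * f u)) (𝟙-∧ (adj G u v) (lookup T u)) ⟩
        𝟙 (lookup S v) * (𝟙 (adj G u v) * 𝟙 (lookup T u) * f u)
          ≡⟨ shuffle (𝟙 (lookup S v)) (𝟙 (adj G u v)) (𝟙 (lookup T u)) (f u) ⟩
        𝟙 (lookup T u) * f u * (𝟙 (adj G u v) * 𝟙 (lookup S v))
          ≡⟨ cong (𝟙 (lookup T u) * f u *_) (𝟙-∧ (adj G u v) (lookup S v)) ⟨
        𝟙 (lookup T u) * f u * 𝟙 (adj G u v ∧ lookup S v) ∎

    edges-comm : ∀ S T → edges S T ≡ edges T S
    edges-comm S T = begin
      edges S T
        ≡⟨ sumFin-cong n (λ v → cong (𝟙 (lookup S v) *_) degree) ⟩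
      sumFin n (λ v → 𝟙 (lookup S v) * sumFin n (λ u → 𝟙 (adj G v u ∧ lookup T u) * 1ℚ))
        ≡⟨ sumFin-over-edges S T (λ _ → 1ℚ) ⟩
      sumFin n (λ u → 𝟙 (lookup T u) * (1ℚ * degInℚ S u))
        ≡⟨ sumFin-cong n (λ u → cong (𝟙 (lookup T u) *_) (ℚ.*-identityˡ (degInℚ S u))) ⟩
      edges T S ∎
      where
      open ≡-Reasoning
      degree : ∀ {v} → degInℚ T v ≡ sumFin n (λ u → 𝟙 (adj G v u ∧ lookup T u) * 1ℚ)
      degree {v} = ≡.sym (trans (sumFin-cong n (λ u → ℚ.*-identityʳ (𝟙 (adj G v u ∧ lookup T u))))
                                (sumFin-𝟙≡countFin n (λ u → adj G v u ∧ lookup T u)))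

    module _ {d} (regular : Regular d G) where

      degIn≤d : ∀ S u → degIn S u ℕ.≤ d
      degIn≤d S u = ≡.subst (degIn S u ℕ.≤_) (regular u) (degIn≤deg S u)

      degInℚ-∁ : ∀ S u → degInℚ S u + degInℚ (∁ S) u ≡ ℕ→ℚ d
      degInℚ-∁ S u = trans (≡.sym (ℕ→ℚ-+ (degIn S u) (degIn (∁ S) u)))
                           (cong ℕ→ℚ (trans (degIn-∁ S u) (regular u)))

      P₂-regular : .{{_ : NonZero d}} → ∀ S → P₂ G S ≡ inv ∣ S ∣ * inv (d ℕ.* d) * squareSum S
      P₂-regular S = begin
        P₂ G S
          ≡⟨ sumFin-cong n (λ v → cong (𝟙 (lookup S v) * inv ∣ S ∣ *_) (two-steps v)) ⟩
        sumFin n (λ v → 𝟙 (lookup S v) * inv ∣ S ∣ * (inv (d ℕ.* d) * neighbourSum v))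
          ≡⟨ sumFin-cong n (λ v → regroup (𝟙 (lookup S v)) (inv ∣ S ∣) (inv (d ℕ.* d)) (neighbourSum v)) ⟩
        sumFin n (λ v → inv ∣ S ∣ * inv (d ℕ.* d) * (𝟙 (lookup S v) * neighbourSum v))
          ≡⟨ *-distribˡ-sumFin n (inv ∣ S ∣ * inv (d ℕ.* d)) (λ v → 𝟙 (lookup S v) * neighbourSum v) ⟨
        inv ∣ S ∣ * inv (d ℕ.* d) * sumFin n (λ v → 𝟙 (lookup S v) * neighbourSum v)
          ≡⟨ cong (inv ∣ S ∣ * inv (d ℕ.* d) *_) (sumFin-over-edges S S (degInℚ S)) ⟩
        inv ∣ S ∣ * inv (d ℕ.* d) * squareSum S ∎
        where
        open ≡-Reasoning
        neighbourSum : Fin n → ℚ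
        neighbourSum v = sumFin n (λ u → 𝟙 (adj G v u ∧ lookup S u) * degInℚ S u)
        regroup : ∀ s i j z → s * i * (j * z) ≡ i * j * (s * z)
        regroup = solve-∀ ℚ-ring
        shuffle : ∀ e c j → e * j * (c * j) ≡ j * j * (e * c)
        shuffle = solve-∀ ℚ-ring
        one-step : ∀ u → sumFin n (λ w → 𝟙 (adj G u w ∧ lookup S w) * inv (deg G u)) ≡ degInℚ S u * inv d
        one-step u = trans (≡.sym (*-distribʳ-sumFin n (inv (deg G u)) (λ w → 𝟙 (adj G u w ∧ lookup S w))))
                           (cong₂ _*_ (sumFin-𝟙≡countFin n (λ w → adj G u w ∧ lookup S w)) (cong inv (regular u)))
        two-steps : ∀ v →
          sumFin n (λ u → 𝟙 (adj G v u ∧ lookup S u) * inv (deg G v) *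
            sumFin n (λ w → 𝟙 (adj G u w ∧ lookup S w) * inv (deg G u)))
            ≡ inv (d ℕ.* d) * neighbourSum v
        two-steps v = begin
          _ ≡⟨ sumFin-cong n (λ u →
                 cong₂ (λ e z → 𝟙 (adj G v u ∧ lookup S u) * inv e * z) (regular v) (one-step u)) ⟩
          sumFin n (λ u → 𝟙 (adj G v u ∧ lookup S u) * inv d * (degInℚ S u * inv d))
            ≡⟨ sumFin-cong n (λ u → shuffle (𝟙 (adj G v u ∧ lookup S u)) (degInℚ S u) (inv d)) ⟩
          sumFin n (λ u → inv d * inv d * (𝟙 (adj G v u ∧ lookup S u) * degInℚ S u))
            ≡⟨ *-distribˡ-sumFin n (inv d * inv d) (λ u → 𝟙 (adj G v u ∧ lookup S u) * degInℚ S u) ⟨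
          inv d * inv d * neighbourSum v
            ≡⟨ cong (_* neighbourSum v) (inv-* d d) ⟨
          inv (d ℕ.* d) * neighbourSum v ∎

      edges-+-∁ : ∀ S T → edges S T + edges S (∁ T) ≡ ℕ→ℚ ∣ S ∣ * ℕ→ℚ d
      edges-+-∁ S T = begin
        edges S T + edges S (∁ T)
          ≡⟨ sumFin-+ n (λ u → 𝟙 (lookup S u) * degInℚ T u) (λ u → 𝟙 (lookup S u) * degInℚ (∁ T) u) ⟨
        sumFin n (λ u → 𝟙 (lookup S u) * degInℚ T u + 𝟙 (lookup S u) * degInℚ (∁ T) u)
          ≡⟨ sumFin-cong n (λ u → trans (≡.sym (ℚ.*-distribˡ-+ (𝟙 (lookup S u)) _ _))
                                        (cong (𝟙 (lookup S u) *_) (degInℚ-∁ T u))) ⟩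
        sumFin n (λ u → 𝟙 (lookup S u) * ℕ→ℚ d)
          ≡⟨ *-distribʳ-sumFin n (ℕ→ℚ d) (λ u → 𝟙 (lookup S u)) ⟨
        sumFin n (λ u → 𝟙 (lookup S u)) * ℕ→ℚ d
          ≡⟨ cong (_* ℕ→ℚ d) (sumFin-𝟙≡∣p∣ S) ⟩
        ℕ→ℚ ∣ S ∣ * ℕ→ℚ d ∎
        where open ≡-Reasoning

      edges-balanced : ∀ R → ∣ R ∣ ≡ ∣ ∁ R ∣ → edges R R ≡ edges (∁ R) (∁ R)
      edges-balanced R balanced = +-cancelʳ (edges R (∁ R)) (edges R R) (edges (∁ R) (∁ R)) (begin
        edges R R + edges R (∁ R)           ≡⟨ edges-+-∁ R R ⟩
        ℕ→ℚ ∣ R ∣ * ℕ→ℚ d                  ≡⟨ cong (λ m → ℕ→ℚ m * ℕ→ℚ d) balanced ⟩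
        ℕ→ℚ ∣ ∁ R ∣ * ℕ→ℚ d                ≡⟨ edges-+-∁ (∁ R) R ⟨
        edges (∁ R) R + edges (∁ R) (∁ R)   ≡⟨ ℚ.+-comm (edges (∁ R) R) (edges (∁ R) (∁ R)) ⟩
        edges (∁ R) (∁ R) + edges (∁ R) R   ≡⟨ cong (edges (∁ R) (∁ R) +_) (edges-comm (∁ R) R) ⟩
        edges (∁ R) (∁ R) + edges R (∁ R)   ∎)
        where open ≡-Reasoning

      squareSum+crossSum : ∀ S → squareSum S + crossSum S ≡ ℕ→ℚ d * edges S S
      squareSum+crossSum S = begin
        squareSum S + crossSum S
          ≡⟨ sumFin-+ n _ _ ⟨
        sumFin n (λ u → 𝟙 (lookup S u) * (degInℚ S u * degInℚ S u)
                      + 𝟙 (lookup S u) * (degInℚ S u * degInℚ (∁ S) u))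
          ≡⟨ sumFin-cong n (λ u → split (𝟙 (lookup S u)) (degInℚ S u) (degInℚ (∁ S) u) (degInℚ-∁ S u)) ⟩
        sumFin n (λ u → ℕ→ℚ d * (𝟙 (lookup S u) * degInℚ S u))
          ≡⟨ *-distribˡ-sumFin n (ℕ→ℚ d) (λ u → 𝟙 (lookup S u) * degInℚ S u) ⟨
        ℕ→ℚ d * edges S S ∎
        where
        open ≡-Reasoning
        split : ∀ s c c′ {D} → c + c′ ≡ D → s * (c * c) + s * (c * c′) ≡ D * (s * c)
        split s c c′ refl = expand s c c′
          where
          expand : ∀ s c c′ → s * (c * c) + s * (c * c′) ≡ (c + c′) * (s * c)
          expand = solve-∀ ℚ-ring

      degreeProfile : Subset n → Fin (suc d) → ℚ
      degreeProfile S = histogram d (λ u → inv ∣ S ∣ * 𝟙 (lookup S u)) (degIn S)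

      mean-degreeProfile : ∀ S g →
        mean d (degreeProfile S) g ≡ inv ∣ S ∣ * sumFin n (λ u → 𝟙 (lookup S u) * g (degIn S u))
      mean-degreeProfile S g = begin
        mean d (degreeProfile S) g
          ≡⟨ mean-histogram d (λ u → inv ∣ S ∣ * 𝟙 (lookup S u)) (degIn S) (degIn≤d S) g ⟩
        sumFin n (λ u → inv ∣ S ∣ * 𝟙 (lookup S u) * g (degIn S u))
          ≡⟨ sumFin-cong n (λ u → ℚ.*-assoc (inv ∣ S ∣) (𝟙 (lookup S u)) (g (degIn S u))) ⟩
        sumFin n (λ u → inv ∣ S ∣ * (𝟙 (lookup S u) * g (degIn S u)))
          ≡⟨ *-distribˡ-sumFin n (inv ∣ S ∣) (λ u → 𝟙 (lookup S u) * g (degIn S u)) ⟨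
        inv ∣ S ∣ * sumFin n (λ u → 𝟙 (lookup S u) * g (degIn S u)) ∎
        where open ≡-Reasoning

      0≤degreeProfile : ∀ S l → 0ℚ ≤ degreeProfile S l
      0≤degreeProfile S l =
        0≤sumFin n (λ u → 0≤* (0≤* (0≤inv ∣ S ∣) (0≤𝟙 (lookup S u))) (0≤𝟙 (degIn S u ℕ.≡ᵇ toℕ l)))

      sumFin-degreeProfile : ∀ S .{{_ : NonZero ∣ S ∣}} → sumFin (suc d) (degreeProfile S) ≡ 1ℚ
      sumFin-degreeProfile S = begin
        sumFin (suc d) (degreeProfile S)
          ≡⟨ sumFin-cong (suc d) (λ l → ℚ.*-identityʳ (degreeProfile S l)) ⟨
        mean d (degreeProfile S) (λ _ → 1ℚ)
          ≡⟨ mean-degreeProfile S (λ _ → 1ℚ) ⟩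
        inv ∣ S ∣ * sumFin n (λ u → 𝟙 (lookup S u) * 1ℚ)
          ≡⟨ cong (inv ∣ S ∣ *_) (sumFin-cong n (λ u → ℚ.*-identityʳ (𝟙 (lookup S u)))) ⟩
        inv ∣ S ∣ * sumFin n (λ u → 𝟙 (lookup S u))
          ≡⟨ cong (inv ∣ S ∣ *_) (sumFin-𝟙≡∣p∣ S) ⟩
        inv ∣ S ∣ * ℕ→ℚ ∣ S ∣
          ≡⟨ ℚ.*-comm (inv ∣ S ∣) (ℕ→ℚ ∣ S ∣) ⟩
        ℕ→ℚ ∣ S ∣ * inv ∣ S ∣
          ≡⟨ ℕ→ℚ*inv ∣ S ∣ ⟩
        1ℚ ∎
        where open ≡-Reasoning

      InD-degreeProfile : ∀ S .{{_ : NonZero ∣ S ∣}} →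
        InD d (inv ∣ S ∣ * inv d * edges S S) (inv ∣ S ∣ * inv (d ℕ.* d) * squareSum S)
      InD-degreeProfile S = subst₂ (InD d) on-linear on-square
        (InD-parabola d (degreeProfile S) (0≤degreeProfile S) (sumFin-degreeProfile S))
        where
        open ≡-Reasoning
        factor : ∀ i s j → i * (s * j) ≡ i * j * s
        factor = solve-∀ ℚ-ring
        pull : ∀ (c : Fin n → ℚ) j →
          sumFin n (λ u → 𝟙 (lookup S u) * (c u * j)) ≡ sumFin n (λ u → 𝟙 (lookup S u) * c u) * j
        pull c j = trans (sumFin-cong n (λ u → ≡.sym (ℚ.*-assoc (𝟙 (lookup S u)) (c u) j)))
                         (≡.sym (*-distribʳ-sumFin n j (λ u → 𝟙 (lookup S u) * c u)))
        on-linear : mean d (degreeProfile S) (linear d) ≡ inv ∣ S ∣ * inv d * edges S S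
        on-linear = begin
          mean d (degreeProfile S) (linear d)
            ≡⟨ mean-degreeProfile S (linear d) ⟩
          inv ∣ S ∣ * sumFin n (λ u → 𝟙 (lookup S u) * (degInℚ S u * inv d))
            ≡⟨ cong (inv ∣ S ∣ *_) (pull (degInℚ S) (inv d)) ⟩
          inv ∣ S ∣ * (edges S S * inv d)
            ≡⟨ factor (inv ∣ S ∣) (edges S S) (inv d) ⟩
          inv ∣ S ∣ * inv d * edges S S ∎
        on-square : mean d (degreeProfile S) (square d) ≡ inv ∣ S ∣ * inv (d ℕ.* d) * squareSum S
        on-square = begin
          mean d (degreeProfile S) (square d)
            ≡⟨ mean-degreeProfile S (square d) ⟩
          inv ∣ S ∣ * sumFin n (λ u → 𝟙 (lookup S u) * (ℕ→ℚ (degIn S u ℕ.* degIn S u) * inv (d ℕ.* d)))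
            ≡⟨ cong (inv ∣ S ∣ *_) (sumFin-cong n (λ u →
                 cong (λ z → 𝟙 (lookup S u) * (z * inv (d ℕ.* d))) (ℕ→ℚ-* (degIn S u) (degIn S u)))) ⟩
          inv ∣ S ∣ * sumFin n (λ u → 𝟙 (lookup S u) * (degInℚ S u * degInℚ S u * inv (d ℕ.* d)))
            ≡⟨ cong (inv ∣ S ∣ *_) (pull (λ u → degInℚ S u * degInℚ S u) (inv (d ℕ.* d))) ⟩
          inv ∣ S ∣ * (squareSum S * inv (d ℕ.* d))
            ≡⟨ factor (inv ∣ S ∣) (squareSum S) (inv (d ℕ.* d)) ⟩
          inv ∣ S ∣ * inv (d ℕ.* d) * squareSum S ∎

      colourTriangle : ∀ R → ∣ R ∣ ≡ ∣ ∁ R ∣ →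
        TriangleWeights (squareSum R) (squareSum (∁ R)) (ℕ→ℚ d * edges R R)
      colourTriangle R balanced = ≡.subst (TriangleWeights _ _) (squareSum+crossSum R)
        (triangleWeights (0≤squareSum R) (0≤squareSum (∁ R)) (0≤crossSum R) (0≤crossSum (∁ R)) slack)
        where
        slack : squareSum R + crossSum R ≡ squareSum (∁ R) + crossSum (∁ R)
        slack = begin
          squareSum R + crossSum R             ≡⟨ squareSum+crossSum R ⟩
          ℕ→ℚ d * edges R R                    ≡⟨ cong (ℕ→ℚ d *_) (edges-balanced R balanced) ⟩
          ℕ→ℚ d * edges (∁ R) (∁ R)            ≡⟨ squareSum+crossSum (∁ R) ⟨
          squareSum (∁ R) + crossSum (∁ R)     ∎
          where open ≡-Reasoning

      P₂-balanced∈D : .{{_ : NonZero d}} → ∀ R {{_ : NonZero ∣ R ∣}} → ∣ R ∣ ≡ ∣ ∁ R ∣ →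
        InD d (P₂ G R) (P₂ G (∁ R))
      P₂-balanced∈D R {{∣R∣≢0}} balanced =
        subst₂ (InD d) (≡.sym (P₂-regular R)) (≡.sym P₂[B]≡)
          (InD-triangle weights (InD-swap (InD-degreeProfile R)) B-point)
        where
        B = ∁ R
        m = ∣ R ∣
        instance
          _ : NonZero ∣ B ∣
          _ = ≡.subst NonZero balanced ∣R∣≢0
        P₂[B]≡ : P₂ G B ≡ inv m * inv (d ℕ.* d) * squareSum B
        P₂[B]≡ = trans (P₂-regular B) (cong (λ k → inv k * inv (d ℕ.* d) * squareSum B) (≡.sym balanced))
        B-point : InD d (inv m * inv d * edges R R) (inv m * inv (d ℕ.* d) * squareSum B)
        B-point = subst₂ (λ k e → InD d (inv k * inv d * e) (inv k * inv (d ℕ.* d) * squareSum B))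
                    (≡.sym balanced) (≡.sym (edges-balanced R balanced)) (InD-degreeProfile B)
        weights : TriangleWeights (inv m * inv (d ℕ.* d) * squareSum R) (inv m * inv (d ℕ.* d) * squareSum B)
                                  (inv m * inv d * edges R R)
        weights = ≡.subst (TriangleWeights _ _) (*-inv[d*d]*d (inv m) d (edges R R))
                    (TriangleWeights-scale (inv m * inv (d ℕ.* d)) (colourTriangle R balanced))

open import Data.Nat using (ℕ; _≤_; _<_; _*_; >-nonZero)
open import Data.Fin.Subset using (Subset; ∣_∣; ∁)
open import Data.Product using (∃)
open import Relation.Binary.PropositionalEquality using (_≡_)

theorem1 : (n d : ℕ) → (G : Graph n) → Regular d G → 1 ≤ d → 0 < n
    → ∃ (λ m → n ≡ 2 * m)
    → (R : Subset n) → ∣ R ∣ ≡ ∣ ∁ R ∣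
    → InD d (P₂ G R) (P₂ G (∁ R))
theorem1 n d G regular 1≤d 0<n _ R balanced =
  P₂-balanced∈D G regular {{>-nonZero 1≤d}} R {{∣p∣-nonZero R 0<n balanced}} balanced
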